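{- Let $V$ be a finite set equipped with two binary operations $+$ and $\times$, both associative and commutative, such that $a\times(b+c)=a\times b+a\times c$ for all $a,b,c\in V$, and such that there are elements $0,1\in V$ with $a+0=a$ and $a\times 1=a$ for all $a\in V$. Assume moreover that $a+a=0$ and $a\times a=a$ for all $a\in V$. If $p$ and $q$ are primes of $V$, then $\sim p\times\sim q=\sim p$ if $p=q$ and $\sim p\times \sim q=0$ if $p\neq q$. Equivalently, for distinct primes $p\neq q$, $p\times q=p+\sim q=\sim p+q$.
   Context: For $a\in V$ the negation is $\sim a:=a+1$. An element $p\in V$ with $p\neq 1$ is called a (logical) prime if for every $a\in V$, $p\times a=0$ implies $a=0$ or $a=\sim p$. -}

module Defs where

open import Level using (Level; suc; _⊔_)
open import Data.Nat using (ℕ)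
open import Data.Fin using (Fin)
open import Data.Product using (Σ; _×_)
open import Data.Sum using (_⊎_)
open import Function.Bundles using (_↔_)
open import Relation.Binary.PropositionalEquality using (_≡_)
open import Relation.Nullary using (¬_)

record FiniteStructure (ℓ : Level) : Set (suc ℓ) where
  infixl 6 _+_
  infixl 7 _·_
  field
    V      : Set ℓ
    finite : Σ ℕ (λ n → Fin n ↔ V)
    _+_    : V → V → V
    _·_    : V → V → V
    𝟘      : V
    𝟙      : V
    +-assoc : ∀ a b c → (a + b) + c ≡ a + (b + c)
    +-comm  : ∀ a b → a + b ≡ b + a
    ×-assoc : ∀ a b c → (a · b) · c ≡ a · (b · c)
    ×-comm  : ∀ a b → a · b ≡ b · a
    distrib : ∀ a b c → a · (b + c) ≡ a · b + a · c
    +-identity : ∀ a → a + 𝟘 ≡ a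
    ×-identity : ∀ a → a · 𝟙 ≡ a
    +-self  : ∀ a → a + a ≡ 𝟘
    ×-self  : ∀ a → a · a ≡ a

  ∼_ : V → V
  ∼ a = a + 𝟙

  IsPrime : V → Set ℓ
  IsPrime p = (¬ (p ≡ 𝟙)) × (∀ a → p · a ≡ 𝟘 → (a ≡ 𝟘) ⊎ (a ≡ ∼ p))

-- The structure V is a commutative ring of characteristic 2 in which every
-- element is idempotent, so  a · ∼ a = a · a + a = 0  for every a.  Hence
-- for any x, p · (∼ p · x) = 0, and primality of p forces ∼ p · x to be 0
-- or ∼ p.  Applying this to x = ∼ q for two primes p and q: either
-- ∼ p · ∼ q = 0, or it equals both ∼ p and ∼ q, in which case p = q
-- because ∼ is an involution.  The case p = q is idempotency.  Finally,
-- expanding (p + 1) · (q + 1) = p · q + (p + ∼ q) turns ∼ p · ∼ q = 0 into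
-- p · q = p + ∼ q, since in characteristic 2 a sum vanishes only when its
-- summands agree.
module Submission where

open import Defs
open import Level using (Level)
open import Data.Product using (_×_; _,_)
open import Data.Sum using (_⊎_; inj₁; inj₂)
open import Data.Empty using (⊥-elim)
open import Relation.Binary.PropositionalEquality
  using (_≡_; refl; sym; trans; cong; cong₂; module ≡-Reasoning)
open import Relation.Nullary using (¬_)

module Properties {ℓ : Level} (S : FiniteStructure ℓ) where
  open FiniteStructure S
  open ≡-Reasoning

  +-cancel-twice : ∀ x y → (x + y) + y ≡ x
  +-cancel-twice x y = begin
    (x + y) + y  ≡⟨ +-assoc x y y ⟩
    x + (y + y)  ≡⟨ cong (x +_) (+-self y) ⟩
    x + 𝟘        ≡⟨ +-identity x ⟩
    x            ∎

  +≡𝟘⇒≡ : ∀ x y → x + y ≡ 𝟘 → x ≡ y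
  +≡𝟘⇒≡ x y x+y≡𝟘 = begin
    x            ≡⟨ sym (+-cancel-twice x y) ⟩
    (x + y) + y  ≡⟨ cong (_+ y) x+y≡𝟘 ⟩
    𝟘 + y        ≡⟨ +-comm 𝟘 y ⟩
    y + 𝟘        ≡⟨ +-identity y ⟩
    y            ∎

  ∼-involutive : ∀ a → ∼ (∼ a) ≡ a
  ∼-involutive a = +-cancel-twice a 𝟙

  ∼-injective : ∀ a b → ∼ a ≡ ∼ b → a ≡ b
  ∼-injective a b ∼a≡∼b = begin
    a          ≡⟨ sym (∼-involutive a) ⟩
    ∼ (∼ a)    ≡⟨ cong ∼_ ∼a≡∼b ⟩
    ∼ (∼ b)    ≡⟨ ∼-involutive b ⟩
    b          ∎

  ·-zeroʳ : ∀ x → x · 𝟘 ≡ 𝟘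
  ·-zeroʳ x = begin
    x · 𝟘          ≡⟨ cong (x ·_) (sym (+-identity 𝟘)) ⟩
    x · (𝟘 + 𝟘)    ≡⟨ distrib x 𝟘 𝟘 ⟩
    x · 𝟘 + x · 𝟘  ≡⟨ +-self (x · 𝟘) ⟩
    𝟘              ∎

  ·-identityˡ : ∀ x → 𝟙 · x ≡ x
  ·-identityˡ x = trans (×-comm 𝟙 x) (×-identity x)

  ·-distribʳ : ∀ a b c → (a + b) · c ≡ a · c + b · c
  ·-distribʳ a b c = begin
    (a + b) · c    ≡⟨ ×-comm (a + b) c ⟩
    c · (a + b)    ≡⟨ distrib c a b ⟩
    c · a + c · b  ≡⟨ cong₂ _+_ (×-comm c a) (×-comm c b) ⟩
    a · c + b · c  ∎

  ·-∼-orthogonal : ∀ a → a · (∼ a) ≡ 𝟘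
  ·-∼-orthogonal a = begin
    a · (a + 𝟙)    ≡⟨ distrib a a 𝟙 ⟩
    a · a + a · 𝟙  ≡⟨ cong₂ _+_ (×-self a) (×-identity a) ⟩
    a + a          ≡⟨ +-self a ⟩
    𝟘              ∎

  annihilates-∼-multiples : ∀ p x → p · ((∼ p) · x) ≡ 𝟘
  annihilates-∼-multiples p x = begin
    p · ((∼ p) · x)  ≡⟨ sym (×-assoc p (∼ p) x) ⟩
    (p · (∼ p)) · x  ≡⟨ cong (_· x) (·-∼-orthogonal p) ⟩
    𝟘 · x            ≡⟨ ×-comm 𝟘 x ⟩
    x · 𝟘            ≡⟨ ·-zeroʳ x ⟩
    𝟘                ∎

  prime-∼-multiples : ∀ p → IsPrime p → ∀ x →
    ((∼ p) · x ≡ 𝟘) ⊎ ((∼ p) · x ≡ ∼ p)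
  prime-∼-multiples p (_ , prime) x = prime ((∼ p) · x) (annihilates-∼-multiples p x)

  distinct-primes-∼-orthogonal : ∀ p q → IsPrime p → IsPrime q → ¬ (p ≡ q) →
    (∼ p) · (∼ q) ≡ 𝟘
  distinct-primes-∼-orthogonal p q p-prime q-prime p≢q
    with prime-∼-multiples p p-prime (∼ q) | prime-∼-multiples q q-prime (∼ p)
  ... | inj₁ ∼p·∼q≡𝟘 | _ = ∼p·∼q≡𝟘
  ... | inj₂ _ | inj₁ ∼q·∼p≡𝟘 = trans (×-comm (∼ p) (∼ q)) ∼q·∼p≡𝟘
  ... | inj₂ ∼p·∼q≡∼p | inj₂ ∼q·∼p≡∼q =
    ⊥-elim (p≢q (∼-injective p q (trans (sym ∼p·∼q≡∼p)
                                        (trans (×-comm (∼ p) (∼ q)) ∼q·∼p≡∼q))))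

  ∼·∼-expand : ∀ p q → (∼ p) · (∼ q) ≡ p · q + (p + ∼ q)
  ∼·∼-expand p q = begin
    (p + 𝟙) · (q + 𝟙)                ≡⟨ ·-distribʳ p 𝟙 (q + 𝟙) ⟩
    p · (q + 𝟙) + 𝟙 · (q + 𝟙)        ≡⟨ cong₂ _+_ (distrib p q 𝟙) (·-identityˡ (q + 𝟙)) ⟩
    (p · q + p · 𝟙) + (q + 𝟙)        ≡⟨ cong (λ z → (p · q + z) + (q + 𝟙)) (×-identity p) ⟩
    (p · q + p) + (q + 𝟙)            ≡⟨ +-assoc (p · q) p (q + 𝟙) ⟩
    p · q + (p + (q + 𝟙))            ∎

  +∼-swap : ∀ p q → p + ∼ q ≡ ∼ p + q
  +∼-swap p q = begin
    p + (q + 𝟙)  ≡⟨ cong (p +_) (+-comm q 𝟙) ⟩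
    p + (𝟙 + q)  ≡⟨ sym (+-assoc p 𝟙 q) ⟩
    (p + 𝟙) + q  ∎

mainTheorem4 : ∀ {ℓ : Level} (S : FiniteStructure ℓ) →
    let open FiniteStructure S in
    ∀ p q → IsPrime p → IsPrime q →
    (p ≡ q → (∼ p) · (∼ q) ≡ ∼ p) ×
    (¬ (p ≡ q) → (∼ p) · (∼ q) ≡ 𝟘) ×
    (¬ (p ≡ q) → (p · q ≡ p + ∼ q) × (p · q ≡ ∼ p + q))
mainTheorem4 S p q p-prime q-prime =
  (λ { refl → ×-self (∼ p) }) , orthogonal , λ p≢q →
    let p·q≡p+∼q = product-formula p≢q in p·q≡p+∼q , trans p·q≡p+∼q (+∼-swap p q)
  where
  open FiniteStructure S
  open Properties S

  orthogonal : ¬ (p ≡ q) → (∼ p) · (∼ q) ≡ 𝟘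
  orthogonal = distinct-primes-∼-orthogonal p q p-prime q-prime

  product-formula : ¬ (p ≡ q) → p · q ≡ p + ∼ q
  product-formula p≢q = +≡𝟘⇒≡ (p · q) (p + ∼ q) (trans (sym (∼·∼-expand p q)) (orthogonal p≢q))
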